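{- Let $\lambda,\mu,\nu\in\Lambda_+$ and $P\in\mathrm{HIVE}^\nu_{\lambda\mu}$. Then $$\widehat{P^\star}=\xi(\widetilde P).$$
   Context: $\Lambda_+$: weakly decreasing $n$-tuples of integers. $\Delta_n=\{(x,y,z)\in\mathbb Z^3_{\ge0}:x+y+z=n\}$; $P:\Delta_n\to\mathbb Z$ satisfies the hive condition if (whenever all points lie in $\Delta_n$) (i) $P(x,y,z)+P(x,y+1,z-1)\ge P(x+1,y,z-1)+P(x-1,y+1,z)$, (ii) $P(x,y,z)+P(x+1,y,z-1)\ge P(x,y+1,z-1)+P(x+1,y-1,z)$, (iii) $P(x,y,z)+P(x+1,y-1,z)\ge P(x+1,y,z-1)+P(x,y-1,z+1)$; hives are such functions modulo constants; $\mathrm{HIVE}^\nu_{\lambda\mu}$: hives with $\lambda_k=P(n-k,k,0)-P(n-k+1,k-1,0)$, $\mu_k=P(k,0,n-k)-P(k-1,0,n-k+1)$, $\nu_k=P(0,k,n-k)-P(0,k-1,n-k+1)$. $\widehat P(i,j)=P(i-j,j,n-i)-P(i-j+1,j-1,n-i)$ and $\widetilde P(i,j)=P(j,n-i,i-j)-P(j-1,n-i,i-j+1)$, $1\le j\le i\le n$ (Gelfand–Tsetlin patterns, i.e. arrays with $T(i,j)\ge T(i-1,j)\ge T(i,j+1)$). $P^\star$: let $\mathcal L=\{(x,y,t)\in\mathbb Z^3:0\le x,y\le n,\ x+y+t\text{ even}\}$. Put $f(z,x,n-y)=P(x,y,z)$ (defining $f$ on points with $t=x+y\le n$), and extend $f$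 inductively in $t$ to all points of $\mathcal L$ with $x+y\le t\le 2n-x-y$ by the modified octahedron recurrence: $f(x,y,t+1)=\max(f(x+1,y,t)+f(x-1,y,t),f(x,y+1,t)+f(x,y-1,t))-f(x,y,t-1)$ if $0<x,y<n$; $=f(x+1,y,t)+f(x-1,y,t)-f(x,y,t-1)$ if $0<x<n,y\in\{0,n\}$; $=f(x,y+1,t)+f(x,y-1,t)-f(x,y,t-1)$ if $0<y<n,x\in\{0,n\}$; $=f(x+1,y,t)+f(x,y+1,t)-f(x,y,t-1)$ at $(0,0)$; $=f(x+1,y,t)+f(x,y-1,t)-f(x,y,t-1)$ at $(0,n)$; $=f(x-1,y,t)+f(x,y+1,t)-f(x,y,t-1)$ at $(n,0)$; $=f(x-1,y,t)+f(x,y-1,t)-f(x,y,t-1)$ at $(n,n)$. Then $P^\star(x,y,z)=f(x,y,n+z)$. Schützenberger involution on Gelfand–Tsetlin patterns: the Bender–Knuth move $s_i$ ($1\le i\le n-1$) changes only row $i$: $s_i(T)(i,j)=\min(T(i+1,j),T(i-1,j-1))+\max(T(i+1,j+1),T(i-1,j))-T(i,j)$, where an undefined argument is omitted from the min/max; $\xi=s_1(s_2s_1)\cdots(s_{n-1}\cdots s_1)$ (composition of maps, $s_1$ applied first). -}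

module Defs where

open import Data.Nat as ℕ using (ℕ; zero; suc; _∸_; _≡ᵇ_; _≤ᵇ_)
open import Data.Integer as ℤ using (ℤ; _-_; _⊔_)
open import Data.Bool using (Bool; true; false; if_then_else_; _∨_; _∧_; not)
open import Data.Fin using (Fin; toℕ)
open import Data.Product using (_×_; _,_; proj₁; proj₂)
open import Relation.Binary.PropositionalEquality using (_≡_)

-- A function P : Δ_n → ℤ is represented by a function ℕ → ℕ → ℕ → ℤ;
-- only its values at points (x,y,z) with x + y + z = n are ever used.
Fun3 : Set
Fun3 = ℕ → ℕ → ℕ → ℤ

-- Gelfand–Tsetlin arrays T(i,j), 1 ≤ j ≤ i ≤ n, represented by ℕ → ℕ → ℤ
-- (entries outside the triangular range are irrelevant).
Array : Set
Array = ℕ → ℕ → ℤ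

-- Hive condition (each inequality required whenever all its points lie in Δ_n)

record IsHive (n : ℕ) (P : Fun3) : Set where
  field
    rhombus-i   : ∀ x y z → x ℕ.+ y ℕ.+ z ≡ n → 1 ℕ.≤ x → 1 ℕ.≤ z →
                  P x y z ℤ.+ P x (suc y) (z ∸ 1) ℤ.≥ P (suc x) y (z ∸ 1) ℤ.+ P (x ∸ 1) (suc y) z
    rhombus-ii  : ∀ x y z → x ℕ.+ y ℕ.+ z ≡ n → 1 ℕ.≤ y → 1 ℕ.≤ z →
                  P x y z ℤ.+ P (suc x) y (z ∸ 1) ℤ.≥ P x (suc y) (z ∸ 1) ℤ.+ P (suc x) (y ∸ 1) z
    rhombus-iii : ∀ x y z → x ℕ.+ y ℕ.+ z ≡ n → 1 ℕ.≤ y → 1 ℕ.≤ z →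
                  P x y z ℤ.+ P (suc x) (y ∸ 1) z ℤ.≥ P (suc x) y (z ∸ 1) ℤ.+ P x (y ∸ 1) (suc z)

-- Λ_+ : weakly decreasing n-tuples of integers (entry k+1 stored at index k)
Dominant : (n : ℕ) → (Fin n → ℤ) → Set
Dominant n lam = ∀ (i j : Fin n) → toℕ i ℕ.≤ toℕ j → lam j ℤ.≤ lam i

record InHIVE (n : ℕ) (lam mu nu : Fin n → ℤ) (P : Fun3) : Set where
  field
    hive     : IsHive n P
    bdry-lam : ∀ (i : Fin n) → let k = suc (toℕ i) in
               lam i ≡ P (n ∸ k) k 0 - P (n ∸ k ℕ.+ 1) (k ∸ 1) 0
    bdry-mu  : ∀ (i : Fin n) → let k = suc (toℕ i) in
               mu i ≡ P k 0 (n ∸ k) - P (k ∸ 1) 0 (n ∸ k ℕ.+ 1)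
    bdry-nu  : ∀ (i : Fin n) → let k = suc (toℕ i) in
               nu i ≡ P 0 k (n ∸ k) - P 0 (k ∸ 1) (n ∸ k ℕ.+ 1)

hat : ℕ → Fun3 → Array
hat n P i j = P (i ∸ j) j (n ∸ i) - P (i ∸ j ℕ.+ 1) (j ∸ 1) (n ∸ i)

tilde : ℕ → Fun3 → Array
tilde n P i j = P j (n ∸ i) (i ∸ j) - P (j ∸ 1) (n ∸ i) (i ∸ j ℕ.+ 1)

-- P⋆ via the modified octahedron recurrence.
-- A layer is the function (x , y) ↦ f(x , y , t) for fixed t.

Layer : Set
Layer = ℕ → ℕ → ℤ

-- initial data: f(z , x , n - y) = P(x , y , z), i.e. f(a , b , a + b) = P(b , n - a - b , a)
initF : ℕ → Fun3 → Layer
initF n P a b = P b (n ∸ (a ℕ.+ b)) a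

-- one step of the recurrence: g = f(·,·,t), h = f(·,·,t-1), result f(x,y,t+1)
octStep : ℕ → Layer → Layer → Layer
octStep n g h x y =
  if not xb ∧ not yb
    then (g (suc x) y ℤ.+ g (x ∸ 1) y) ⊔ (g x (suc y) ℤ.+ g x (y ∸ 1)) - h x y
  else if not xb
    then g (suc x) y ℤ.+ g (x ∸ 1) y - h x y
  else if not yb
    then g x (suc y) ℤ.+ g x (y ∸ 1) - h x y
  else xn ℤ.+ yn - h x y
  where
    xb = (x ≡ᵇ 0) ∨ (x ≡ᵇ n)
    yb = (y ≡ᵇ 0) ∨ (y ≡ᵇ n)
    xn = if x ≡ᵇ 0 then g (suc x) y else g (x ∸ 1) y
    yn = if y ≡ᵇ 0 then g x (suc y) else g x (y ∸ 1)

-- layers t = (f(·,·,t) , f(·,·,t-1)); at points with t ≤ x + y the initial data is used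
-- (only t = x + y, x + y ≤ n, is a genuine point of the initial region)
layers : ℕ → Fun3 → ℕ → Layer × Layer
layers n P zero = initF n P , initF n P
layers n P (suc t) =
  (λ x y → if suc t ≤ᵇ x ℕ.+ y then initF n P x y
           else octStep n (proj₁ (layers n P t)) (proj₂ (layers n P t)) x y)
  , proj₁ (layers n P t)

octF : ℕ → Fun3 → ℕ → ℕ → ℕ → ℤ
octF n P x y t = proj₁ (layers n P t) x y

star : ℕ → Fun3 → Fun3
star n P x y z = octF n P x y (n ℕ.+ z)

minOpt : ℤ → Bool → ℤ → ℤ
minOpt a b c = if b then a ℤ.⊓ c else a

maxOpt : ℤ → Bool → ℤ → ℤ
maxOpt a b c = if b then a ⊔ c else a

-- s_i : changes only row i (entries 1 ≤ j ≤ i); T(i-1,j-1) exists iff 2 ≤ j,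
-- T(i-1,j) exists iff j ≤ i - 1; T(i+1,j), T(i+1,j+1) always exist.
bk : ℕ → Array → Array
bk i T a j =
  if (a ≡ᵇ i) ∧ (1 ≤ᵇ j) ∧ (j ≤ᵇ i)
    then minOpt (T (suc i) j) (2 ≤ᵇ j) (T (i ∸ 1) (j ∸ 1))
         ℤ.+ maxOpt (T (suc i) (suc j)) (j ≤ᵇ i ∸ 1) (T (i ∸ 1) j)
         - T i j
    else T a j

-- block k = s_k ∘ ⋯ ∘ s_1  (s_1 applied first)
bkBlock : ℕ → Array → Array
bkBlock zero T = T
bkBlock (suc k) T = bk (suc k) (bkBlock k T)

-- xiUpTo m = block 1 ∘ block 2 ∘ ⋯ ∘ block m
xiUpTo : ℕ → Array → Array
xiUpTo zero T = T
xiUpTo (suc m) T = xiUpTo m (bkBlock (suc m) T)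

-- ξ = s_1 (s_2 s_1) ⋯ (s_{n-1} ⋯ s_1)
xi : ℕ → Array → Array
xi n = xiUpTo (n ∸ 1)

{-# OPTIONS --safe #-}
-- Taking differences along the antidiagonal x + y = a of the layer f(·,·,t), as in
-- the definition of hat, gives row a of a triangular array "at time t"; at time a
-- it is row a of P̃, at time n + (n - a) it is row a of the hat of P⋆.  Subtracting the
-- modified octahedron recurrence at the adjacent points (x, y) and (x + 1, y - 1), after
-- shifting both maxima by a common term, shows that row a at time t + 2 is the
-- Bender–Knuth move s_a of row a at time t, taken against rows a ± 1 at time t + 1.
-- Whenever ξ applies s_a, rows a ± 1 are exactly one step ahead of row a, so each move
-- advances row a by two steps; row a is moved n - a times, from time a to n + (n - a).
module Submission where

open import Data.Bool using (true; false; T; if_then_else_)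
open import Data.Fin using (Fin)
open import Data.Integer as ℤ using (ℤ; _-_; -_; _⊔_; _⊓_)
import Data.Integer.Properties as ℤP
open import Data.Integer.Tactic.RingSolver using (solve-∀)
open import Data.Nat using (ℕ; zero; suc; _+_; _*_; _∸_; _≤ᵇ_; _≤_; _<_; _≤?_; _≟_; z≤n; s≤s)
import Data.Nat.Properties as ℕP
import Data.Nat.Tactic.RingSolver as ℕ-Solver
open import Data.Product using (_,_)
open import Relation.Binary.Definitions using (tri<; tri≈; tri>)
open import Relation.Binary.PropositionalEquality
open import Relation.Nullary using (yes; no; contradiction)
open import Relation.Nullary.Decidable using (dec-true; dec-false)

open import Defs

if-≤ᵇ-yes : ∀ {A : Set} {a k} {x y : A} → a ≤ k → (if a ≤ᵇ k then x else y) ≡ x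
if-≤ᵇ-yes {a = a} {k} a≤k rewrite dec-true (a ≤? k) a≤k = refl

if-≤ᵇ-no : ∀ {A : Set} {a k} {x y : A} → k < a → (if a ≤ᵇ k then x else y) ≡ y
if-≤ᵇ-no {a = a} {k} k<a rewrite dec-false (a ≤? k) (ℕP.<⇒≱ k<a) = refl

≤ᵇ≡true⇒≤ : ∀ {m k} → (m ≤ᵇ k) ≡ true → m ≤ k
≤ᵇ≡true⇒≤ {m} {k} eq = ℕP.≤ᵇ⇒≤ m k (subst T (sym eq) _)

1≤ᵇx≡1+y≤ᵇy+x : ∀ x y → (1 ≤ᵇ x) ≡ (suc y ≤ᵇ y + x)
1≤ᵇx≡1+y≤ᵇy+x zero    y =
  sym (dec-false (suc y ≤? y + 0) (ℕP.<⇒≱ (s≤s (ℕP.≤-reflexive (ℕP.+-identityʳ y)))))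
1≤ᵇx≡1+y≤ᵇy+x (suc x) y =
  sym (dec-true (suc y ≤? y + suc x) (subst (suc y ≤_) (sym (ℕP.+-suc y x)) (s≤s (ℕP.m≤m+n y x))))

maxOpt-+ : ∀ a b c k → maxOpt a b c ℤ.+ k ≡ maxOpt (a ℤ.+ k) b (c ℤ.+ k)
maxOpt-+ a false c k = refl
maxOpt-+ a true  c k = ℤP.mono-<-distrib-⊔ (ℤ._+ k) (ℤP.+-monoˡ-< k) a c

neg-minOpt : ∀ a b c → - minOpt a b c ≡ maxOpt (- a) b (- c)
neg-minOpt a false c = refl
neg-minOpt a true  c = ℤP.neg-distrib-⊓-⊔ a c

minOpt-cong : ∀ {a a′ b b′ c c′} → a ≡ a′ → b ≡ b′ → (b ≡ true → c ≡ c′) →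
              minOpt a b c ≡ minOpt a′ b′ c′
minOpt-cong {b = false} refl refl _   = refl
minOpt-cong {b = true}  refl refl c≡c′ = cong (_ ⊓_) (c≡c′ refl)

maxOpt-cong : ∀ {a a′ b b′ c c′} → a ≡ a′ → b ≡ b′ → (b ≡ true → c ≡ c′) →
              maxOpt a b c ≡ maxOpt a′ b′ c′
maxOpt-cong {b = false} refl refl _   = refl
maxOpt-cong {b = true}  refl refl c≡c′ = cong (_ ⊔_) (c≡c′ refl)

-- Both maxima are shifted by p + s, which then cancels.
octahedron-difference : ∀ b c p q r s u v hA hB →
  (maxOpt (r ℤ.+ s) b (p ℤ.+ q) - hA) - (maxOpt (u ℤ.+ s) c (p ℤ.+ v) - hB)
    ≡ minOpt (p - u) c (s - v) ℤ.+ maxOpt (r - p) b (q - s) - (hA - hB)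
octahedron-difference b c p q r s u v hA hB = begin
  (maxOpt (r ℤ.+ s) b (p ℤ.+ q) - hA) - (maxOpt (u ℤ.+ s) c (p ℤ.+ v) - hB)
    ≡⟨ cong₂ (λ A B → (A - hA) - (B - hB)) left right ⟩
  (M ℤ.+ K - hA) - (- m ℤ.+ K - hB)
    ≡⟨ cancel m M K hA hB ⟩
  m ℤ.+ M - (hA - hB) ∎
  where
  open ≡-Reasoning
  K = p ℤ.+ s
  M = maxOpt (r - p) b (q - s)
  m = minOpt (p - u) c (s - v)

  shiftˡ : ∀ p r s → r ℤ.+ s ≡ (r - p) ℤ.+ (p ℤ.+ s)
  shiftˡ = solve-∀
  shiftʳ : ∀ p q s → p ℤ.+ q ≡ (q - s) ℤ.+ (p ℤ.+ s)
  shiftʳ = solve-∀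
  negShiftˡ : ∀ p s u → u ℤ.+ s ≡ - (p - u) ℤ.+ (p ℤ.+ s)
  negShiftˡ = solve-∀
  negShiftʳ : ∀ p s v → p ℤ.+ v ≡ - (s - v) ℤ.+ (p ℤ.+ s)
  negShiftʳ = solve-∀
  cancel : ∀ m M K hA hB → (M ℤ.+ K - hA) - (- m ℤ.+ K - hB) ≡ m ℤ.+ M - (hA - hB)
  cancel = solve-∀

  left : maxOpt (r ℤ.+ s) b (p ℤ.+ q) ≡ M ℤ.+ K
  left = begin
    maxOpt (r ℤ.+ s) b (p ℤ.+ q)
      ≡⟨ cong₂ (λ A B → maxOpt A b B) (shiftˡ p r s) (shiftʳ p q s) ⟩
    maxOpt ((r - p) ℤ.+ K) b ((q - s) ℤ.+ K)
      ≡⟨ maxOpt-+ (r - p) b (q - s) K ⟨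
    M ℤ.+ K ∎

  right : maxOpt (u ℤ.+ s) c (p ℤ.+ v) ≡ - m ℤ.+ K
  right = begin
    maxOpt (u ℤ.+ s) c (p ℤ.+ v)
      ≡⟨ cong₂ (λ A B → maxOpt A c B) (negShiftˡ p s u) (negShiftʳ p s v) ⟩
    maxOpt (- (p - u) ℤ.+ K) c (- (s - v) ℤ.+ K)
      ≡⟨ maxOpt-+ (- (p - u)) c (- (s - v)) K ⟨
    maxOpt (- (p - u)) c (- (s - v)) ℤ.+ K
      ≡⟨ cong (ℤ._+ K) (neg-minOpt (p - u) c (s - v)) ⟨
    - m ℤ.+ K ∎

octStep-y-interior : ∀ {n} g h x y → x < n → suc y < n →
  octStep n g h x (suc y)
    ≡ maxOpt (g x (suc (suc y)) ℤ.+ g x y) (1 ≤ᵇ x) (g (suc x) (suc y) ℤ.+ g (x ∸ 1) (suc y))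
      - h x (suc y)
octStep-y-interior {n} g h zero y _ 1+y<n
  rewrite dec-false (suc y ≟ n) (ℕP.<⇒≢ 1+y<n) = refl
octStep-y-interior {n} g h (suc x) y 1+x<n 1+y<n
  rewrite dec-false (suc x ≟ n) (ℕP.<⇒≢ 1+x<n) | dec-false (suc y ≟ n) (ℕP.<⇒≢ 1+y<n) =
  cong (_- h (suc x) (suc y))
    (ℤP.⊔-comm (g (suc (suc x)) (suc y) ℤ.+ g x (suc y)) (g (suc x) (suc (suc y)) ℤ.+ g (suc x) y))

octStep-x-interior : ∀ {n} g h x y → suc x < n → y < n →
  octStep n g h (suc x) y
    ≡ maxOpt (g (suc (suc x)) y ℤ.+ g x y) (1 ≤ᵇ y) (g (suc x) (suc y) ℤ.+ g (suc x) (y ∸ 1))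
      - h (suc x) y
octStep-x-interior {n} g h x zero 1+x<n _
  rewrite dec-false (suc x ≟ n) (ℕP.<⇒≢ 1+x<n) = refl
octStep-x-interior {n} g h x (suc y) 1+x<n 1+y<n
  rewrite dec-false (suc x ≟ n) (ℕP.<⇒≢ 1+x<n) | dec-false (suc y ≟ n) (ℕP.<⇒≢ 1+y<n) = refl

BenderKnuthRecurrence : ℕ → (ℕ → Array) → Set
BenderKnuthRecurrence n G = ∀ {t i j} → i < n → i ≤ suc t → 1 ≤ j → j ≤ i →
  G (2 + t) i j
    ≡ minOpt (G (suc t) (suc i) j) (2 ≤ᵇ j) (G (suc t) (i ∸ 1) (j ∸ 1))
      ℤ.+ maxOpt (G (suc t) (suc i) (suc j)) (j ≤ᵇ i ∸ 1) (G (suc t) (i ∸ 1) j)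
      - G t i j

-- Row a of U has undergone `moves a` Bender–Knuth moves, each advancing it two
-- time steps from time a.
record RowsAt (n : ℕ) (G : ℕ → Array) (moves : ℕ → ℕ) (U : Array) : Set where
  field
    rowAt : ∀ {a j} → 1 ≤ j → j ≤ a → a ≤ n → U a j ≡ G (a + 2 * moves a) a j

open RowsAt

RowsAt-cong : ∀ {n G moves moves′ U} → (∀ {a} → 1 ≤ a → a ≤ n → moves a ≡ moves′ a) →
              RowsAt n G moves U → RowsAt n G moves′ U
RowsAt-cong {G = G} moves≡ rows .rowAt {a} {j} 1≤j j≤a a≤n =
  trans (rowAt rows 1≤j j≤a a≤n) (cong (λ m → G (a + 2 * m) a j) (moves≡ (ℕP.≤-trans 1≤j j≤a) a≤n))

-- Row a takes part in the block s_M ⋯ s_1 of ξ iff a ≤ M, so after the r blocks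
-- s_{n-1} ⋯ s_1, …, s_{n-r} ⋯ s_1 it has been moved min(r, n - a) times.
afterBlocks : ℕ → ℕ → ℕ → ℕ
afterBlocks n r a = if a + r ≤ᵇ n then r else n ∸ a

duringBlock : ℕ → ℕ → ℕ → ℕ → ℕ
duringBlock n r k a = if a ≤ᵇ k then suc r else afterBlocks n r a

afterBlocks-saturated : ∀ {n} r a → n ≤ a + r → afterBlocks n r a ≡ n ∸ a
afterBlocks-saturated {n} r a n≤a+r with a + r ≤? n
... | yes a+r≤n = begin
  afterBlocks n r a ≡⟨ if-≤ᵇ-yes a+r≤n ⟩
  r           ≡⟨ ℕP.m+n∸m≡n a r ⟨
  a + r ∸ a   ≡⟨ cong (_∸ a) (ℕP.≤-antisym a+r≤n n≤a+r) ⟩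
  n ∸ a       ∎
  where open ≡-Reasoning
... | no a+r≰n = if-≤ᵇ-no (ℕP.≰⇒> a+r≰n)

duringBlock-end : ∀ {n} M r a → M + suc r ≡ n → duringBlock n r M a ≡ afterBlocks n (suc r) a
duringBlock-end {n} M r a M+1+r≡n with a ≤? M
... | yes a≤M = trans (if-≤ᵇ-yes a≤M)
                      (sym (if-≤ᵇ-yes (subst (a + suc r ≤_) M+1+r≡n (ℕP.+-monoˡ-≤ (suc r) a≤M))))
... | no a≰M = trans (if-≤ᵇ-no M<a)
                     (trans (afterBlocks-saturated r a n≤a+r) (sym (afterBlocks-saturated (suc r) a n≤a+1+r)))
  where
  M<a : M < a
  M<a = ℕP.≰⇒> a≰M
  n≤a+r : n ≤ a + r
  n≤a+r = subst (_≤ a + r) (trans (sym (ℕP.+-suc M r)) M+1+r≡n) (ℕP.+-monoˡ-≤ r M<a)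
  n≤a+1+r : n ≤ a + suc r
  n≤a+1+r = ℕP.≤-trans n≤a+r (ℕP.+-monoʳ-≤ a (ℕP.n≤1+n r))

module _ {n : ℕ} {G : ℕ → Array} (recurrence : BenderKnuthRecurrence n G) where

  RowsAt-bk : ∀ {moves moves′ U i v} → RowsAt n G moves U → i < n →
              moves i ≡ v → moves (suc i) ≡ v → (2 ≤ i → moves (i ∸ 1) ≡ suc v) →
              moves′ i ≡ suc v → (∀ {a} → a ≢ i → moves′ a ≡ moves a) →
              RowsAt n G moves′ (bk i U)
  RowsAt-bk {i = i} rows _ _ _ _ _ elsewhere .rowAt {a} {j} 1≤j j≤a a≤n with a ≟ i
  ... | no a≢i rewrite dec-false (a ≟ i) a≢i =
    trans (rowAt rows 1≤j j≤a a≤n) (cong (λ m → G (a + 2 * m) a j) (sym (elsewhere a≢i)))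
  RowsAt-bk {moves} {_} {U} {suc i} {v} rows i<n here above below here′ _
            .rowAt {.(suc i)} {suc y} 1≤j j≤a a≤n | yes refl
    rewrite dec-true (i ≟ i) refl | dec-true (suc y ≤? suc i) j≤a | here′ = begin
      minOpt (U (2 + i) (suc y)) (2 ≤ᵇ suc y) (U i y)
        ℤ.+ maxOpt (U (2 + i) (2 + y)) (suc y ≤ᵇ i) (U i (suc y))
        - U (suc i) (suc y)
        ≡⟨ cong₂ _-_ (cong₂ ℤ._+_
             (minOpt-cong (upper 1≤j (ℕP.m≤n⇒m≤1+n j≤a)) refl λ 2≤ᵇ1+y →
               lower (ℕP.≤-pred (≤ᵇ≡true⇒≤ 2≤ᵇ1+y)) (ℕP.≤-pred j≤a))
             (maxOpt-cong (upper (s≤s z≤n) (s≤s j≤a)) refl λ 1+y≤ᵇi → lower 1≤j (≤ᵇ≡true⇒≤ 1+y≤ᵇi)))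
             (row here 1≤j j≤a a≤n refl) ⟩
      minOpt (G (suc t) (2 + i) (suc y)) (2 ≤ᵇ suc y) (G (suc t) i y)
        ℤ.+ maxOpt (G (suc t) (2 + i) (2 + y)) (suc y ≤ᵇ i) (G (suc t) i (suc y))
        - G t (suc i) (suc y)
        ≡⟨ recurrence i<n (ℕP.m≤n⇒m≤1+n (ℕP.m≤m+n (suc i) (2 * v))) 1≤j j≤a ⟨
      G (2 + t) (suc i) (suc y)
        ≡⟨ cong (λ s → G s (suc i) (suc y)) (moved-time (suc i) v) ⟨
      G (suc i + 2 * suc v) (suc i) (suc y) ∎
    where
    open ≡-Reasoning
    t = suc i + 2 * v

    row : ∀ {b k w s} → moves b ≡ w → 1 ≤ k → k ≤ b → b ≤ n → b + 2 * w ≡ s → U b k ≡ G s b k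
    row refl 1≤k k≤b b≤n refl = rowAt rows 1≤k k≤b b≤n

    lower-time : ∀ i v → i + 2 * suc v ≡ suc (suc i + 2 * v)
    lower-time = ℕ-Solver.solve-∀

    moved-time : ∀ a v → a + 2 * suc v ≡ 2 + (a + 2 * v)
    moved-time = ℕ-Solver.solve-∀

    upper : ∀ {k} → 1 ≤ k → k ≤ 2 + i → U (2 + i) k ≡ G (suc t) (2 + i) k
    upper 1≤k k≤2+i = row above 1≤k k≤2+i i<n refl

    lower : ∀ {k} → 1 ≤ k → k ≤ i → U i k ≡ G (suc t) i k
    lower 1≤k k≤i =
      row (below (s≤s (ℕP.≤-trans 1≤k k≤i))) 1≤k k≤i (ℕP.≤-trans (ℕP.n≤1+n i) a≤n) (lower-time i v)

  bkBlock-RowsAt : ∀ {M r U} → M + suc r ≡ n → RowsAt n G (afterBlocks n r) U →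
                   ∀ {k} → k ≤ M → RowsAt n G (duringBlock n r k) (bkBlock k U)
  bkBlock-RowsAt _ rows {zero} _ = RowsAt-cong (λ 1≤a _ → sym (if-≤ᵇ-no 1≤a)) rows
  bkBlock-RowsAt {M} {r} M+1+r≡n rows {suc k} k<M =
    RowsAt-bk (bkBlock-RowsAt M+1+r≡n rows (ℕP.<⇒≤ k<M)) 1+k<n here above (λ _ → below) here′ elsewhere
    where
    fits : suc k + suc r ≤ n
    fits = subst (suc k + suc r ≤_) M+1+r≡n (ℕP.+-monoˡ-≤ (suc r) k<M)

    1+k<n : suc k < n
    1+k<n = ℕP.<-≤-trans (ℕP.m<m+n (suc k) (s≤s z≤n)) fits

    here : duringBlock n r k (suc k) ≡ r
    here = trans (if-≤ᵇ-no (ℕP.n<1+n k))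
                 (if-≤ᵇ-yes (ℕP.≤-trans (ℕP.+-monoʳ-≤ (suc k) (ℕP.n≤1+n r)) fits))

    above : duringBlock n r k (2 + k) ≡ r
    above = trans (if-≤ᵇ-no (ℕP.m<n+m k (s≤s z≤n)))
                  (if-≤ᵇ-yes (subst (_≤ n) (ℕP.+-suc (suc k) r) fits))

    below : duringBlock n r k k ≡ suc r
    below = if-≤ᵇ-yes (ℕP.≤-refl {k})

    here′ : duringBlock n r (suc k) (suc k) ≡ suc r
    here′ = if-≤ᵇ-yes (ℕP.≤-refl {suc k})

    elsewhere : ∀ {a} → a ≢ suc k → duringBlock n r (suc k) a ≡ duringBlock n r k a
    elsewhere {a} a≢1+k with ℕP.<-cmp a (suc k)
    ... | tri< a<1+k _ _ = trans (if-≤ᵇ-yes (ℕP.<⇒≤ a<1+k)) (sym (if-≤ᵇ-yes (ℕP.≤-pred a<1+k)))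
    ... | tri≈ _ a≡1+k _ = contradiction a≡1+k a≢1+k
    ... | tri> _ _ 1+k<a = trans (if-≤ᵇ-no 1+k<a) (sym (if-≤ᵇ-no (ℕP.<-trans (ℕP.n<1+n k) 1+k<a)))

  xiUpTo-RowsAt : ∀ {M r U} → M + suc r ≡ n → RowsAt n G (afterBlocks n r) U →
                  RowsAt n G (n ∸_) (xiUpTo M U)
  xiUpTo-RowsAt {zero} {r} 1+r≡n rows =
    RowsAt-cong (λ {a} 1≤a _ → afterBlocks-saturated r a (subst (_≤ a + r) 1+r≡n (ℕP.+-monoˡ-≤ r 1≤a)))
                rows
  xiUpTo-RowsAt {suc M} {r} M+2+r≡n rows =
    xiUpTo-RowsAt (trans (ℕP.+-suc M (suc r)) M+2+r≡n)
      (RowsAt-cong (λ {a} _ _ → duringBlock-end (suc M) r a M+2+r≡n)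
                   (bkBlock-RowsAt M+2+r≡n rows ℕP.≤-refl))

  xi-RowsAt : ∀ {U} → 1 ≤ n → RowsAt n G (λ _ → 0) U → RowsAt n G (n ∸_) (xi n U)
  xi-RowsAt 1≤n rows = xiUpTo-RowsAt (ℕP.m∸n+n≡m 1≤n)
    (RowsAt-cong (λ {a} _ a≤n → sym (if-≤ᵇ-yes (subst (_≤ n) (sym (ℕP.+-identityʳ a)) a≤n))) rows)

module _ (n : ℕ) (P : Fun3) where

  layer : ℕ → Layer
  layer t x y = octF n P x y t

  layer-init : ∀ t x y → t ≤ x + y → layer t x y ≡ initF n P x y
  layer-init zero    x y _     = refl
  layer-init (suc t) x y t<x+y rewrite dec-true (suc t ≤? x + y) t<x+y = refl

  layer-step : ∀ {t} x y → x + y ≤ suc t → layer (2 + t) x y ≡ octStep n (layer (suc t)) (layer t) x y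
  layer-step {t} x y x+y≤1+t rewrite dec-false (2 + t ≤? x + y) (ℕP.<⇒≱ (s≤s x+y≤1+t)) = refl

  layerGT : ℕ → Array
  layerGT t = hat n (λ x y _ → layer t x y)

  layerGT-entry : ∀ t x y {a} → a ≡ suc y + x →
                  layerGT t a (suc y) ≡ layer t x (suc y) - layer t (suc x) y
  layerGT-entry t x y refl rewrite ℕP.m+n∸m≡n (suc y) x | ℕP.+-comm x 1 = refl

  layerGT-recurrence : BenderKnuthRecurrence n layerGT
  layerGT-recurrence {t} {i} {suc y} i<n i≤1+t _ j≤i with ℕP.m≤n⇒∃[o]m+o≡n j≤i
  ... | x , refl = begin
    layerGT (2 + t) (suc y + x) (suc y)
      ≡⟨ layerGT-entry (2 + t) x y refl ⟩
    layer (2 + t) x (suc y) - layer (2 + t) (suc x) y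
      ≡⟨ cong₂ _-_ (trans (layer-step x (suc y) x+1+y≤1+t) (octStep-y-interior g h x y x<n 1+y<n))
                   (trans (layer-step (suc x) y (subst (_≤ suc t) (ℕP.+-suc x y) x+1+y≤1+t))
                          (octStep-x-interior g h x y 1+x<n y<n)) ⟩
    (maxOpt (r ℤ.+ s) (1 ≤ᵇ x) (p ℤ.+ q) - h x (suc y))
      - (maxOpt (u ℤ.+ s) (1 ≤ᵇ y) (p ℤ.+ v) - h (suc x) y)
      ≡⟨ octahedron-difference (1 ≤ᵇ x) (1 ≤ᵇ y) p q r s u v (h x (suc y)) (h (suc x) y) ⟩
    minOpt (p - u) (1 ≤ᵇ y) (s - v) ℤ.+ maxOpt (r - p) (1 ≤ᵇ x) (q - s) - (h x (suc y) - h (suc x) y)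
      ≡⟨ cong₂ _-_ (cong₂ ℤ._+_
           (minOpt-cong (sym (layerGT-entry (suc t) (suc x) y (sym (ℕP.+-suc (suc y) x)))) refl (lower-min y))
           (maxOpt-cong (sym (layerGT-entry (suc t) x (suc y) refl)) (1≤ᵇx≡1+y≤ᵇy+x x y) (lower-max x)))
           (sym (layerGT-entry t x y refl)) ⟩
    minOpt (layerGT (suc t) (2 + y + x) (suc y)) (2 ≤ᵇ suc y) (layerGT (suc t) (y + x) y)
      ℤ.+ maxOpt (layerGT (suc t) (2 + y + x) (2 + y)) (suc y ≤ᵇ y + x) (layerGT (suc t) (y + x) (suc y))
      - layerGT t (suc y + x) (suc y) ∎
    where
    open ≡-Reasoning
    g = layer (suc t)
    h = layer t
    p = g (suc x) (suc y)
    q = g (x ∸ 1) (suc y)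
    r = g x (2 + y)
    s = g x y
    u = g (2 + x) y
    v = g (suc x) (y ∸ 1)

    x+1+y≤1+t : x + suc y ≤ suc t
    x+1+y≤1+t = subst (_≤ suc t) (ℕP.+-comm (suc y) x) i≤1+t
    x<n : x < n
    x<n = ℕP.≤-<-trans (ℕP.m≤n+m x (suc y)) i<n
    1+y<n : suc y < n
    1+y<n = ℕP.≤-<-trans (ℕP.m≤m+n (suc y) x) i<n
    y<n : y < n
    y<n = ℕP.<-trans (ℕP.n<1+n y) 1+y<n
    1+x<n : suc x < n
    1+x<n = ℕP.≤-<-trans (ℕP.m≤n+m (suc x) y) (subst (_< n) (sym (ℕP.+-suc y x)) i<n)

    lower-min : ∀ y → (1 ≤ᵇ y) ≡ true → g x y - g (suc x) (y ∸ 1) ≡ layerGT (suc t) (y + x) y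
    lower-min (suc y) _ = sym (layerGT-entry (suc t) x y refl)

    lower-max : ∀ x → (1 ≤ᵇ x) ≡ true → g (x ∸ 1) (suc y) - g x y ≡ layerGT (suc t) (y + x) (suc y)
    lower-max (suc x) _ = sym (layerGT-entry (suc t) x y (ℕP.+-suc y x))

  tilde-RowsAt : RowsAt n layerGT (λ _ → 0) (tilde n P)
  tilde-RowsAt .rowAt {_} {suc y} _ j≤a _ with ℕP.m≤n⇒∃[o]m+o≡n j≤a
  ... | x , refl = begin
    tilde n P (suc y + x) (suc y)
      ≡⟨ cong₂ (λ c d → P (suc y) (n ∸ (suc y + x)) c - P y (n ∸ (suc y + x)) d)
               x-eq (trans (cong (_+ 1) x-eq) (ℕP.+-comm x 1)) ⟩
    P (suc y) (n ∸ (suc y + x)) x - P y (n ∸ (suc y + x)) (suc x)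
      ≡⟨ cong₂ (λ c d → P (suc y) (n ∸ c) x - P y (n ∸ d) (suc x))
               (ℕP.+-comm (suc y) x) (cong suc (ℕP.+-comm y x)) ⟩
    initF n P x (suc y) - initF n P (suc x) y
      ≡⟨ cong₂ _-_ (layer-init t x (suc y) (ℕP.≤-reflexive (trans t≡a (ℕP.+-comm (suc y) x))))
                   (layer-init t (suc x) y (ℕP.≤-reflexive (trans t≡a (cong suc (ℕP.+-comm y x))))) ⟨
    layer t x (suc y) - layer t (suc x) y
      ≡⟨ layerGT-entry t x y refl ⟨
    layerGT t (suc y + x) (suc y) ∎
    where
    open ≡-Reasoning
    t = suc y + x + 2 * 0
    t≡a : t ≡ suc y + x
    t≡a = ℕP.+-identityʳ (suc y + x)
    x-eq : suc y + x ∸ suc y ≡ x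
    x-eq = ℕP.m+n∸m≡n (suc y) x

n+[n∸a]≡a+2*[n∸a] : ∀ {n a} → a ≤ n → n + (n ∸ a) ≡ a + 2 * (n ∸ a)
n+[n∸a]≡a+2*[n∸a] {n} {a} a≤n = begin
  n + (n ∸ a)              ≡⟨ cong (_+ (n ∸ a)) (ℕP.m+[n∸m]≡n a≤n) ⟨
  a + (n ∸ a) + (n ∸ a)    ≡⟨ regroup a (n ∸ a) ⟩
  a + 2 * (n ∸ a)          ∎
  where
  open ≡-Reasoning
  regroup : ∀ a d → a + d + d ≡ a + 2 * d
  regroup = ℕ-Solver.solve-∀

theorem7p15 : (n : ℕ) (lam mu nu : Fin n → ℤ) (P : Fun3) →
    Dominant n lam → Dominant n mu → Dominant n nu →
    InHIVE n lam mu nu P →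
    ∀ (i j : ℕ) → 1 ≤ j → j ≤ i → i ≤ n →
    hat n (star n P) i j ≡ xi n (tilde n P) i j
theorem7p15 n _ _ _ P _ _ _ _ i j 1≤j j≤i i≤n = begin
  hat n (star n P) i j
    ≡⟨⟩
  layerGT n P (n + (n ∸ i)) i j
    ≡⟨ cong (λ t → layerGT n P t i j) (n+[n∸a]≡a+2*[n∸a] i≤n) ⟩
  layerGT n P (i + 2 * (n ∸ i)) i j
    ≡⟨ rowAt xi-rows 1≤j j≤i i≤n ⟨
  xi n (tilde n P) i j ∎
  where
  open ≡-Reasoning
  xi-rows : RowsAt n (layerGT n P) (n ∸_) (xi n (tilde n P))
  xi-rows = xi-RowsAt (layerGT-recurrence n P) (ℕP.≤-trans (ℕP.≤-trans 1≤j j≤i) i≤n) (tilde-RowsAt n P)
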